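{- Let $p_1,\dots,p_k$ be pairwise relatively prime positive integers and $n=p_1p_2\cdots p_k$. Then $\tilde\Phi_{p_1,\dots,p_k}(x)$ is the greatest common divisor (normalized to be monic) of the polynomials $1+x^{n/p_i}+x^{2n/p_i}+\dots+x^{n(p_i-1)/p_i}$, $i=1,2,\dots,k$.
   Context: For pairwise relatively prime positive integers $p_1,\dots,p_k$, the pseudocyclotomic polynomial is $\tilde\Phi_{p_1,\dots,p_k}(x)=\prod_{I\subseteq\{1,\dots,k\}}\bigl(x^{\prod_{i\in I}p_i}-1\bigr)^{(-1)^{k-|I|}}$ (empty product of the $p_i$ equals $1$). -}

module Defs where

open import Data.Bool using (Bool; true; false; if_then_else_)
open import Data.Nat as ℕ using (ℕ; zero; suc; _≤_; _<_; NonZero; >-nonZero)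
open import Data.Nat.DivMod using (_/_)
open import Data.Fin using (Fin; zero; suc)
open import Data.Vec using (Vec; []; _∷_)
open import Data.List using (List; []; _∷_; [_]; _++_; map; foldr; replicate)
open import Data.Rational using (ℚ; 0ℚ; 1ℚ; -_) renaming (_+_ to _+ℚ_; _*_ to _*ℚ_)
open import Data.Product using (Σ; _×_)
open import Relation.Binary.PropositionalEquality using (_≡_)

-- Polynomials with rational coefficients, as coefficient lists
-- (constant term first).  Trailing zeros are allowed; equality is
-- coefficientwise (_≈ₚ_).
Poly : Set
Poly = List ℚ

coeff : Poly → ℕ → ℚ
coeff []      _       = 0ℚ
coeff (a ∷ p) zero    = a
coeff (a ∷ p) (suc i) = coeff p i

_≈ₚ_ : Poly → Poly → Set
p ≈ₚ q = ∀ i → coeff p i ≡ coeff q i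

infixl 6 _+ₚ_
infixl 7 _*ₚ_

_+ₚ_ : Poly → Poly → Poly
[]      +ₚ q       = q
(a ∷ p) +ₚ []      = a ∷ p
(a ∷ p) +ₚ (b ∷ q) = (a +ℚ b) ∷ (p +ₚ q)

_*ₚ_ : Poly → Poly → Poly
[]      *ₚ q = []
(a ∷ p) *ₚ q = map (a *ℚ_) q +ₚ (0ℚ ∷ (p *ₚ q))

oneₚ : Poly
oneₚ = [ 1ℚ ]

monomial : ℕ → Poly
monomial m = replicate m 0ℚ ++ [ 1ℚ ]

xpowMinusOne : ℕ → Poly
xpowMinusOne m = monomial m +ₚ [ - 1ℚ ]

prodₚ : List Poly → Poly
prodₚ = foldr _*ₚ_ oneₚ

_∣ₚ_ : Poly → Poly → Set
d ∣ₚ f = Σ Poly λ r → (r *ₚ d) ≈ₚ f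

Monic : Poly → Set
Monic g = Σ ℕ λ d → (coeff g d ≡ 1ℚ) × (∀ i → d < i → coeff g i ≡ 0ℚ)

IsMonicGCD : {k : ℕ} → Poly → (Fin k → Poly) → Set
IsMonicGCD {k} g f =
  Monic g × ((i : Fin k) → g ∣ₚ f i)
          × ((h : Poly) → ((i : Fin k) → h ∣ₚ f i) → h ∣ₚ g)

-- subsets of {1..k} as characteristic vectors; all of them
subsets : (k : ℕ) → List (Vec Bool k)
subsets zero    = [ [] ]
subsets (suc k) = map (false ∷_) (subsets k) ++ map (true ∷_) (subsets k)

card : {k : ℕ} → Vec Bool k → ℕ
card []           = 0
card (true  ∷ bs) = suc (card bs)
card (false ∷ bs) = card bs

subProd : {k : ℕ} → Vec Bool k → (Fin k → ℕ) → ℕ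
subProd []       p = 1
subProd (b ∷ bs) p = (if b then p zero else 1) ℕ.* subProd bs (λ i → p (suc i))

fullProd : (k : ℕ) → (Fin k → ℕ) → ℕ
fullProd zero    p = 1
fullProd (suc k) p = p zero ℕ.* fullProd k (λ i → p (suc i))

evenᵇ : ℕ → Bool
evenᵇ zero          = true
evenᵇ (suc zero)    = false
evenᵇ (suc (suc n)) = evenᵇ n

-- Φ̃ = Num / Den, where Num collects the factors (x^{∏_I p_i} - 1) with
-- exponent (-1)^{k-|I|} = +1 and Den those with exponent -1.
pcNum : (k : ℕ) → (Fin k → ℕ) → Poly
pcNum k p = prodₚ (map (λ I → if evenᵇ (k ℕ.∸ card I)
                                then xpowMinusOne (subProd I p) else oneₚ)
                       (subsets k))

pcDen : (k : ℕ) → (Fin k → ℕ) → Poly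
pcDen k p = prodₚ (map (λ I → if evenᵇ (k ℕ.∸ card I)
                                then oneₚ else xpowMinusOne (subProd I p))
                       (subsets k))

-- Φ̃ is (as a rational function) the polynomial P with P · Den = Num
IsPseudocyclotomic : (k : ℕ) → (Fin k → ℕ) → Poly → Set
IsPseudocyclotomic k p P = (P *ₚ pcDen k p) ≈ₚ pcNum k p

geomPoly : ℕ → ℕ → Poly
geomPoly m zero    = []
geomPoly m (suc j) = geomPoly m j +ₚ monomial (j ℕ.* m)

gcdFamily : (k : ℕ) → (p : Fin k → ℕ) → ((i : Fin k) → 1 ≤ p i) → Fin k → Poly
gcdFamily k p pos i =
  geomPoly ((fullProd k p / p i) {{>-nonZero (pos i)}}) (p i)

{-# OPTIONS --safe #-}

-- Write Φ̃_p(y) for the pseudocyclotomic polynomial evaluated at a polynomial y.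
-- Splitting p = (q , p′), the subsets containing q contribute exactly the factors
-- of Φ̃_p′(y^q) and the others those of 1/Φ̃_p′(y), so Φ̃_p(y) = Φ̃_p′(y^q)/Φ̃_p′(y).
-- By induction on k, for every y such that all y^j − 1 (j ≥ 1) are monic, Φ̃_p(y)
-- is a monic polynomial and a gcd of y^n − 1 and of the sums 1 + z + ⋯ + z^(pᵢ−1)
-- with z = y^(n/pᵢ); the theorem is the case y = x. In the step, Φ̃_p′(y) divides
-- Φ̃_p′(y^q) because such a sum for z divides the one for z^q when pᵢ and q are
-- coprime (a Bézout relation between pᵢ and q yields one between the sums); the
-- quotient divides the new sum 1 + w + ⋯ + w^(q−1), w = y^n′, after cancelling
-- Φ̃_p′(y); and it is the greatest divisor because that sum is ≡ q modulo w − 1,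
-- with q invertible in ℚ, hence coprime to w − 1 and so to Φ̃_p′(y).

module Submission where

open import Defs
open import Data.Nat using (ℕ; _≤_)
open import Data.Nat.Coprimality using (Coprime)
open import Data.Fin using (Fin)
open import Data.Product using (Σ; _×_)
open import Relation.Binary.PropositionalEquality using (_≢_)

open import Level using (0ℓ; _⊔_)
open import Algebra.Bundles using (CommutativeRing; CommutativeSemigroup; Semiring; Monoid)
open import Algebra.Structures using (IsCommutativeMonoid)
open import Data.Bool using (Bool; true; false; if_then_else_; not)
open import Data.List using (List; []; _∷_; [_]; _++_; map; foldr)
import Data.List.Properties as List
open import Data.Nat using (zero; suc; _∸_; _<_; z≤n; s≤s)
import Data.Nat as ℕ
import Data.Nat.Properties as ℕ
open import Data.Nat.Coprimality using (coprime-Bézout)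
open import Data.Nat.DivMod using (_/_; m*n/n≡m)
open import Data.Nat.GCD using (module Bézout)
open import Data.Fin using (zero; suc)
import Data.Fin.Properties as Fin
open import Data.Product using (∃; ∃₂; _,_; proj₂)
open import Data.Vec using (Vec; []; _∷_)
open import Data.Vec.Functional using (head; tail)
open import Function using (_∘_)
open import Relation.Binary.PropositionalEquality as ≡ using (_≡_)

-- Comaximal and cancellable elements of a commutative ring

module Comaximality {c ℓ} (R : CommutativeRing c ℓ) where

  open CommutativeRing R
  open import Algebra.Properties.Ring ring using (-‿distribˡ-*)
  open import Algebra.Properties.CommutativeSemigroup *-commutativeSemigroup
    using (x∙yz≈y∙xz)
  open import Algebra.Properties.Semiring.Divisibility semiring using (_∣_; _,_)
  open import Relation.Binary.Reasoning.Setoid setoid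

  Comaximal : Carrier → Carrier → Set (c ⊔ ℓ)
  Comaximal x y = ∃₂ λ u v → u * x + v * y ≈ 1#

  Invertible : Carrier → Set (c ⊔ ℓ)
  Invertible u = ∃ λ w → w * u ≈ 1#

  Cancellable : Carrier → Set (c ⊔ ℓ)
  Cancellable a = ∀ {x y} → a * x ≈ a * y → x ≈ y

  comaximal-sym : ∀ {x y} → Comaximal x y → Comaximal y x
  comaximal-sym (u , v , eq) = v , u , trans (+-comm _ _) eq

  comaximal-∣ˡ : ∀ {x x′ y} → x ∣ x′ → Comaximal x′ y → Comaximal x y
  comaximal-∣ˡ {x} {x′} {y} (q , qx≈x′) (u , v , eq) = u * q , v , (begin
    u * q * x + v * y   ≈⟨ +-congʳ (trans (*-assoc u q x) (*-congˡ qx≈x′)) ⟩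
    u * x′ + v * y      ≈⟨ eq ⟩
    1#                  ∎)

  cancellable⇒∣-cancel : ∀ {a b c} → Cancellable a → a * b ∣ a * c → b ∣ c
  cancellable⇒∣-cancel {a} {b} {c} cancel (s , s[ab]≈ac) = s , cancel (begin
    a * (s * b)   ≈⟨ x∙yz≈y∙xz a s b ⟩
    s * (a * b)   ≈⟨ s[ab]≈ac ⟩
    a * c         ∎)

  comaximal⇒∣xz∧∣yz⇒∣z : ∀ {x y d z} → Comaximal x y → d ∣ x * z → d ∣ y * z → d ∣ z
  comaximal⇒∣xz∧∣yz⇒∣z {x} {y} {d} {z} (u , v , eq) (q , qd≈xz) (r , rd≈yz) =
    u * q + v * r , (begin
      (u * q + v * r) * d       ≈⟨ distribʳ d (u * q) (v * r) ⟩
      u * q * d + v * r * d     ≈⟨ +-cong (trans (*-assoc u q d) (*-congˡ qd≈xz))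
                                          (trans (*-assoc v r d) (*-congˡ rd≈yz)) ⟩
      u * (x * z) + v * (y * z) ≈⟨ +-cong (*-assoc u x z) (*-assoc v y z) ⟨
      u * x * z + v * y * z     ≈⟨ distribʳ z (u * x) (v * y) ⟨
      (u * x + v * y) * z       ≈⟨ *-congʳ eq ⟩
      1# * z                    ≈⟨ *-identityˡ z ⟩
      z                         ∎)

  ux≈1+vy⇒comaximal : ∀ {u v x y} → u * x ≈ 1# + v * y → Comaximal x y
  ux≈1+vy⇒comaximal {u} {v} {x} {y} eq = u , - v , (begin
    u * x + - v * y          ≈⟨ +-cong (sym eq) (-‿distribˡ-* v y) ⟨
    1# + v * y + - (v * y)   ≈⟨ +-assoc 1# (v * y) (- (v * y)) ⟩
    1# + (v * y - v * y)     ≈⟨ +-congˡ (-‿inverseʳ (v * y)) ⟩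
    1# + 0#                  ≈⟨ +-identityʳ 1# ⟩
    1#                       ∎)

  x≈u+yr⇒comaximal : ∀ {u r x y} → Invertible u → x ≈ u + y * r → Comaximal x y
  x≈u+yr⇒comaximal {u} {r} {x} {y} (w , wu≈1) eq = ux≈1+vy⇒comaximal (begin
    w * x              ≈⟨ *-congˡ eq ⟩
    w * (u + y * r)    ≈⟨ distribˡ w u (y * r) ⟩
    w * u + w * (y * r) ≈⟨ +-cong wu≈1 (trans (x∙yz≈y∙xz w y r) (*-comm y (w * r))) ⟩
    1# + w * r * y     ∎)

-- Geometric sums

module GeometricSums {c ℓ} (R : CommutativeRing c ℓ) where

  open CommutativeRing R
  open Comaximality R
  open import Algebra.Properties.Semiring.Exp semiring using (_^_; ^-congˡ; ^-homo-*; ^-assocʳ)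
  open import Algebra.Definitions.RawSemiring (Semiring.rawSemiring semiring)
    using () renaming (_×_ to _×ᴿ_)
  open import Algebra.Properties.Ring ring using (-‿distribʳ-*)
  open import Algebra.Properties.CommutativeSemigroup +-commutativeSemigroup
    using () renaming (interchange to +-interchange)
  open import Algebra.Properties.CommutativeSemigroup *-commutativeSemigroup
    using (x∙yz≈y∙xz)
  open import Algebra.Properties.CommutativeSemigroup.Divisibility *-commutativeSemigroup
    using (_∣_; _,_; x∣xy; ∣ʳ-respʳ-≈)
  open import Relation.Binary.Reasoning.Setoid setoid

  geom : Carrier → ℕ → Carrier
  geom y zero    = 0#
  geom y (suc j) = geom y j + y ^ j

  geom-congˡ : ∀ {y y′} j → y ≈ y′ → geom y j ≈ geom y′ j
  geom-congˡ zero    y≈y′ = refl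
  geom-congˡ (suc j) y≈y′ = +-cong (geom-congˡ j y≈y′) (^-congˡ j y≈y′)

  uv-1≈[u-1]+u[v-1] : ∀ u v → u * v - 1# ≈ (u - 1#) + u * (v - 1#)
  uv-1≈[u-1]+u[v-1] u v = sym (begin
    (u - 1#) + u * (v - 1#)
      ≈⟨ +-congˡ (distribˡ u v (- 1#)) ⟩
    (u - 1#) + (u * v + u * - 1#)
      ≈⟨ +-congˡ (+-congˡ (trans (-‿cong (sym (*-identityʳ u))) (-‿distribʳ-* u 1#))) ⟨
    (u - 1#) + (u * v - u)
      ≈⟨ +-comm (u - 1#) (u * v - u) ⟩
    (u * v - u) + (u - 1#)
      ≈⟨ +-assoc (u * v) (- u) (u - 1#) ⟩
    u * v + (- u + (u - 1#))
      ≈⟨ +-congˡ (+-assoc (- u) u (- 1#)) ⟨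
    u * v + ((- u + u) - 1#)
      ≈⟨ +-congˡ (+-congʳ (-‿inverseˡ u)) ⟩
    u * v + (0# - 1#)
      ≈⟨ +-congˡ (+-identityˡ (- 1#)) ⟩
    u * v - 1#                       ∎)

  [y-1]*geom≈y^j-1 : ∀ y j → (y - 1#) * geom y j ≈ y ^ j - 1#
  [y-1]*geom≈y^j-1 y zero    = trans (zeroʳ (y - 1#)) (sym (-‿inverseʳ 1#))
  [y-1]*geom≈y^j-1 y (suc j) = begin
    (y - 1#) * (geom y j + y ^ j)
      ≈⟨ distribˡ (y - 1#) (geom y j) (y ^ j) ⟩
    (y - 1#) * geom y j + (y - 1#) * y ^ j
      ≈⟨ +-cong ([y-1]*geom≈y^j-1 y j) (*-comm (y - 1#) (y ^ j)) ⟩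
    (y ^ j - 1#) + y ^ j * (y - 1#)
      ≈⟨ uv-1≈[u-1]+u[v-1] (y ^ j) y ⟨
    y ^ j * y - 1#
      ≈⟨ +-congʳ (*-comm (y ^ j) y) ⟩
    y ^ suc j - 1#                               ∎

  geom∣y^j-1 : ∀ y j → geom y j ∣ y ^ j - 1#
  geom∣y^j-1 y j = y - 1# , [y-1]*geom≈y^j-1 y j

  y^[a+b]-1 : ∀ y a b → y ^ (a ℕ.+ b) - 1# ≈ (y ^ a - 1#) + y ^ a * (y ^ b - 1#)
  y^[a+b]-1 y a b = trans (+-congʳ (^-homo-* y a b)) (uv-1≈[u-1]+u[v-1] (y ^ a) (y ^ b))

  geom-+ : ∀ y a b → geom y (a ℕ.+ b) ≈ geom y a + y ^ a * geom y b
  geom-+ y a zero    = begin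
    geom y (a ℕ.+ 0)          ≡⟨ ≡.cong (geom y) (ℕ.+-identityʳ a) ⟩
    geom y a                  ≈⟨ +-identityʳ (geom y a) ⟨
    geom y a + 0#             ≈⟨ +-congˡ (zeroʳ (y ^ a)) ⟨
    geom y a + y ^ a * 0#     ∎
  geom-+ y a (suc b) = begin
    geom y (a ℕ.+ suc b)
      ≡⟨ ≡.cong (geom y) (ℕ.+-suc a b) ⟩
    geom y (a ℕ.+ b) + y ^ (a ℕ.+ b)
      ≈⟨ +-cong (geom-+ y a b) (^-homo-* y a b) ⟩
    geom y a + y ^ a * geom y b + y ^ a * y ^ b
      ≈⟨ +-assoc (geom y a) (y ^ a * geom y b) (y ^ a * y ^ b) ⟩
    geom y a + (y ^ a * geom y b + y ^ a * y ^ b)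
      ≈⟨ +-congˡ (distribˡ (y ^ a) (geom y b) (y ^ b)) ⟨
    geom y a + y ^ a * geom y (suc b)                  ∎

  geom-*-geom : ∀ y a b → geom y a * geom (y ^ a) b ≈ geom y (b ℕ.* a)
  geom-*-geom y a zero    = zeroʳ (geom y a)
  geom-*-geom y a (suc b) = begin
    geom y a * (geom (y ^ a) b + (y ^ a) ^ b)
      ≈⟨ distribˡ (geom y a) (geom (y ^ a) b) ((y ^ a) ^ b) ⟩
    geom y a * geom (y ^ a) b + geom y a * (y ^ a) ^ b
      ≈⟨ +-cong (geom-*-geom y a b) (*-comm (geom y a) ((y ^ a) ^ b)) ⟩
    geom y (b ℕ.* a) + (y ^ a) ^ b * geom y a
      ≈⟨ +-congˡ (*-congʳ (trans (^-assocʳ y a b) (reflexive (≡.cong (y ^_) (ℕ.*-comm a b))))) ⟩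
    geom y (b ℕ.* a) + y ^ (b ℕ.* a) * geom y a
      ≈⟨ geom-+ y (b ℕ.* a) a ⟨
    geom y (b ℕ.* a ℕ.+ a)
      ≡⟨ ≡.cong (geom y) (ℕ.+-comm (b ℕ.* a) a) ⟩
    geom y (suc b ℕ.* a)                               ∎

  y^j≈1+[y-1]*geom : ∀ y j → y ^ j ≈ 1# + (y - 1#) * geom y j
  y^j≈1+[y-1]*geom y j = begin
    y ^ j                      ≈⟨ +-identityˡ (y ^ j) ⟨
    0# + y ^ j                 ≈⟨ +-congʳ (-‿inverseʳ 1#) ⟨
    (1# - 1#) + y ^ j          ≈⟨ +-assoc 1# (- 1#) (y ^ j) ⟩
    1# + (- 1# + y ^ j)        ≈⟨ +-congˡ (+-comm (- 1#) (y ^ j)) ⟩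
    1# + (y ^ j - 1#)          ≈⟨ +-congˡ ([y-1]*geom≈y^j-1 y j) ⟨
    1# + (y - 1#) * geom y j   ∎

  geom≈j+[y-1]*r : ∀ y j → ∃ λ r → geom y j ≈ j ×ᴿ 1# + (y - 1#) * r
  geom≈j+[y-1]*r y zero    = 0# , sym (trans (+-identityˡ _) (zeroʳ (y - 1#)))
  geom≈j+[y-1]*r y (suc j) with geom≈j+[y-1]*r y j
  ... | r , eq = r + geom y j , (begin
    geom y j + y ^ j
      ≈⟨ +-cong eq (y^j≈1+[y-1]*geom y j) ⟩
    (j ×ᴿ 1# + (y - 1#) * r) + (1# + (y - 1#) * geom y j)
      ≈⟨ +-interchange (j ×ᴿ 1#) _ 1# _ ⟩
    (j ×ᴿ 1# + 1#) + ((y - 1#) * r + (y - 1#) * geom y j)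
      ≈⟨ +-cong (+-comm 1# (j ×ᴿ 1#)) (distribˡ (y - 1#) r (geom y j)) ⟨
    suc j ×ᴿ 1# + (y - 1#) * (r + geom y j)                        ∎)

  comaximal-geom-[y-1] : ∀ {y j} → Invertible (j ×ᴿ 1#) → Comaximal (geom y j) (y - 1#)
  comaximal-geom-[y-1] {y} {j} inv = x≈u+yr⇒comaximal inv (proj₂ (geom≈j+[y-1]*r y j))

  comaximal-geom-geom-Bézout : ∀ {y} → Cancellable (y - 1#) → ∀ {a b s t} →
    1 ℕ.+ t ℕ.* b ≡ s ℕ.* a → Comaximal (geom y a) (geom y b)
  comaximal-geom-geom-Bézout {y} cancel {a} {b} {s} {t} eq = ux≈1+vy⇒comaximal (cancel (begin
    (y - 1#) * (geom (y ^ a) s * geom y a)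
      ≈⟨ *-congˡ (*-comm (geom (y ^ a) s) (geom y a)) ⟩
    (y - 1#) * (geom y a * geom (y ^ a) s)
      ≈⟨ *-congˡ (geom-*-geom y a s) ⟩
    (y - 1#) * geom y (s ℕ.* a)
      ≈⟨ [y-1]*geom≈y^j-1 y (s ℕ.* a) ⟩
    y ^ (s ℕ.* a) - 1#
      ≡⟨ ≡.cong (λ n → y ^ n - 1#) eq ⟨
    y ^ (1 ℕ.+ t ℕ.* b) - 1#
      ≈⟨ y^[a+b]-1 y 1 (t ℕ.* b) ⟩
    (y ^ 1 - 1#) + y ^ 1 * (y ^ (t ℕ.* b) - 1#)
      ≈⟨ +-cong (+-congʳ (*-identityʳ y)) (*-cong (*-identityʳ y) (sym ([y-1]*geom≈y^j-1 y (t ℕ.* b)))) ⟩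
    (y - 1#) + y * ((y - 1#) * geom y (t ℕ.* b))
      ≈⟨ +-cong (*-identityʳ (y - 1#)) (x∙yz≈y∙xz (y - 1#) y _) ⟨
    (y - 1#) * 1# + (y - 1#) * (y * geom y (t ℕ.* b))
      ≈⟨ distribˡ (y - 1#) 1# _ ⟨
    (y - 1#) * (1# + y * geom y (t ℕ.* b))
      ≈⟨ *-congˡ (+-congˡ (*-congˡ (geom-*-geom y b t))) ⟨
    (y - 1#) * (1# + y * (geom y b * geom (y ^ b) t))
      ≈⟨ *-congˡ (+-congˡ (trans (*-congˡ (*-comm _ _)) (sym (*-assoc y _ _)))) ⟩
    (y - 1#) * (1# + y * geom (y ^ b) t * geom y b) ∎))

  comaximal-geom-geom : ∀ {y} → Cancellable (y - 1#) → ∀ {a b} → Coprime a b →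
    Comaximal (geom y a) (geom y b)
  comaximal-geom-geom cancel {a} {b} cop with coprime-Bézout cop
  ... | Bézout.+- s t eq = comaximal-geom-geom-Bézout cancel {a} {b} {s} {t} eq
  ... | Bézout.-+ s t eq = comaximal-sym (comaximal-geom-geom-Bézout cancel {b} {a} {t} {s} eq)

  geom-∣-geom : ∀ {y} → Cancellable (y - 1#) → ∀ {a q} → Coprime a q →
    geom y a ∣ geom (y ^ q) a
  geom-∣-geom {y} cancel {a} {q} cop =
    comaximal⇒∣xz∧∣yz⇒∣z (comaximal-geom-geom cancel cop) (x∣xy (geom y a) _)
      (∣ʳ-respʳ-≈ geom-product-swap (x∣xy (geom y a) (geom (y ^ a) q)))
    where
    geom-product-swap : geom y a * geom (y ^ a) q ≈ geom y q * geom (y ^ q) a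
    geom-product-swap = begin
      geom y a * geom (y ^ a) q   ≈⟨ geom-*-geom y a q ⟩
      geom y (q ℕ.* a)            ≡⟨ ≡.cong (geom y) (ℕ.*-comm q a) ⟩
      geom y (a ℕ.* q)            ≈⟨ geom-*-geom y q a ⟨
      geom y q * geom (y ^ q) a   ∎

-- Products over subsets

evenᵇ-suc : ∀ n → evenᵇ (suc n) ≡ not (evenᵇ n)
evenᵇ-suc zero          = ≡.refl
evenᵇ-suc (suc zero)    = ≡.refl
evenᵇ-suc (suc (suc n)) = evenᵇ-suc n

card≤ : ∀ {k} (I : Vec Bool k) → card I ≤ k
card≤ []          = z≤n
card≤ (true ∷ I)  = s≤s (card≤ I)
card≤ (false ∷ I) = ℕ.m≤n⇒m≤1+n (card≤ I)

module SubsetProducts {c ℓ} (R : CommutativeRing c ℓ) where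

  open CommutativeRing R
  open import Algebra.Properties.Semiring.Exp semiring using (_^_; ^-assocʳ)
  open import Relation.Binary.Reasoning.Setoid setoid

  ∏ : List Carrier → Carrier
  ∏ = foldr _*_ 1#

  ∏-++ : ∀ xs ys → ∏ (xs ++ ys) ≈ ∏ xs * ∏ ys
  ∏-++ []       ys = sym (*-identityˡ (∏ ys))
  ∏-++ (x ∷ xs) ys = trans (*-congˡ (∏-++ xs ys)) (sym (*-assoc x (∏ xs) (∏ ys)))

  ∏-map-cong : ∀ {A : Set} {f g : A → Carrier} → (∀ a → f a ≈ g a) →
    ∀ xs → ∏ (map f xs) ≈ ∏ (map g xs)
  ∏-map-cong f≈g []       = refl
  ∏-map-cong f≈g (x ∷ xs) = *-cong (f≈g x) (∏-map-cong f≈g xs)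

  numFactor : (k : ℕ) → (Fin k → ℕ) → Carrier → Vec Bool k → Carrier
  numFactor k p y I = if evenᵇ (k ∸ card I) then y ^ subProd I p - 1# else 1#

  denFactor : (k : ℕ) → (Fin k → ℕ) → Carrier → Vec Bool k → Carrier
  denFactor k p y I = if evenᵇ (k ∸ card I) then 1# else y ^ subProd I p - 1#

  Num : (k : ℕ) → (Fin k → ℕ) → Carrier → Carrier
  Num k p y = ∏ (map (numFactor k p y) (subsets k))

  Den : (k : ℕ) → (Fin k → ℕ) → Carrier → Carrier
  Den k p y = ∏ (map (denFactor k p y) (subsets k))

  ∏-subsets-suc : ∀ k (f : Vec Bool (suc k) → Carrier) →
    ∏ (map f (subsets (suc k))) ≈ ∏ (map (f ∘ (false ∷_)) (subsets k)) * ∏ (map (f ∘ (true ∷_)) (subsets k))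
  ∏-subsets-suc k f = begin
    ∏ (map f (subsets (suc k)))
      ≡⟨ ≡.cong ∏ (List.map-++ f (map (false ∷_) (subsets k)) _) ⟩
    ∏ (map f (map (false ∷_) (subsets k)) ++ map f (map (true ∷_) (subsets k)))
      ≈⟨ ∏-++ (map f (map (false ∷_) (subsets k))) _ ⟩
    ∏ (map f (map (false ∷_) (subsets k))) * ∏ (map f (map (true ∷_) (subsets k)))
     
       ≡⟨ ≡.cong₂ (λ xs ys → ∏ xs * ∏ ys) (≡.sym (List.map-∘ (subsets k))) (≡.sym (List.map-∘ (subsets k))) ⟩
    ∏ (map (f ∘ (false ∷_)) (subsets k)) * ∏ (map (f ∘ (true ∷_)) (subsets k)) ∎

  private
    exponent-false : ∀ {k} (I : Vec Bool k) p → subProd (false ∷ I) p ≡ subProd I (tail p)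
    exponent-false I p = ℕ.*-identityˡ (subProd I (tail p))

    power-true : ∀ {k} y (I : Vec Bool k) p → y ^ subProd (true ∷ I) p ≈ (y ^ head p) ^ subProd I (tail p)
    power-true y I p = sym (^-assocʳ y (head p) (subProd I (tail p)))

    parity-false : ∀ {k} (I : Vec Bool k) → evenᵇ (suc k ∸ card I) ≡ not (evenᵇ (k ∸ card I))
    parity-false {k} I = ≡.trans (≡.cong evenᵇ (ℕ.+-∸-assoc 1 (card≤ I))) (evenᵇ-suc (k ∸ card I))

  numFactor-false : ∀ k p y (I : Vec Bool k) → numFactor (suc k) p y (false ∷ I) ≈ denFactor k (tail p) y I
  numFactor-false k p y I rewrite parity-false I | exponent-false I p with evenᵇ (k ∸ card I)
  ... | true  = refl
  ... | false = refl

  denFactor-false : ∀ k p y (I : Vec Bool k) → denFactor (suc k) p y (false ∷ I) ≈ numFactor k (tail p) y I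
  denFactor-false k p y I rewrite parity-false I | exponent-false I p with evenᵇ (k ∸ card I)
  ... | true  = refl
  ... | false = refl

  numFactor-true : ∀ k p y (I : Vec Bool k) →
    numFactor (suc k) p y (true ∷ I) ≈ numFactor k (tail p) (y ^ head p) I
  numFactor-true k p y I with evenᵇ (k ∸ card I)
  ... | true  = +-congʳ (power-true y I p)
  ... | false = refl

  denFactor-true : ∀ k p y (I : Vec Bool k) →
    denFactor (suc k) p y (true ∷ I) ≈ denFactor k (tail p) (y ^ head p) I
  denFactor-true k p y I with evenᵇ (k ∸ card I)
  ... | true  = refl
  ... | false = +-congʳ (power-true y I p)

  Num-suc : ∀ k p y → Num (suc k) p y ≈ Den k (tail p) y * Num k (tail p) (y ^ head p)
  Num-suc k p y = trans (∏-subsets-suc k (numFactor (suc k) p y))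
    (*-cong (∏-map-cong (numFactor-false k p y) (subsets k))
            (∏-map-cong (numFactor-true k p y) (subsets k)))

  Den-suc : ∀ k p y → Den (suc k) p y ≈ Num k (tail p) y * Den k (tail p) (y ^ head p)
  Den-suc k p y = trans (∏-subsets-suc k (denFactor (suc k) p y))
    (*-cong (∏-map-cong (denFactor-false k p y) (subsets k))
            (∏-map-cong (denFactor-true k p y) (subsets k)))

-- The ring ℚ[x]

open import Data.Rational using (ℚ; 0ℚ; 1ℚ; -_; 1/_; >-nonZero)
  renaming (_+_ to _+ℚ_; _*_ to _*ℚ_; _<_ to _<ℚ_; _≤_ to _≤ℚ_)
import Data.Rational.Properties as ℚ
open import Relation.Binary.Bundles using (Setoid)
open import Relation.Binary.Structures using (IsEquivalence)
open import Relation.Binary.Definitions using (tri<; tri≈; tri>)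
import Relation.Binary.Reasoning.Setoid as SetoidReasoning
open import Relation.Nullary using (Dec; yes; no; ¬_; contradiction)
open import Relation.Binary.PropositionalEquality
  using (refl; sym; trans; cong; cong₂; subst; module ≡-Reasoning)

-- Coefficientwise equality, wrapped in a record so that unification can
-- recover both polynomials from it.
infix 4 _≋_
record _≋_ (p q : Poly) : Set where
  constructor coeffwise
  field coeff-≡ : p ≈ₚ q
open _≋_

≋-isEquivalence : IsEquivalence _≋_
≋-isEquivalence = record
  { refl  = coeffwise λ _ → refl
  ; sym   = λ (coeffwise e) → coeffwise λ i → sym (e i)
  ; trans = λ (coeffwise e) (coeffwise f) → coeffwise λ i → trans (e i) (f i)
  }

infixr 7 _·ₚ_
_·ₚ_ : ℚ → Poly → Poly
a ·ₚ p = map (a *ℚ_) p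

-ₚ_ : Poly → Poly
-ₚ_ = map -_

coeff-+ₚ : ∀ p q i → coeff (p +ₚ q) i ≡ coeff p i +ℚ coeff q i
coeff-+ₚ []      q       i       = sym (ℚ.+-identityˡ (coeff q i))
coeff-+ₚ (a ∷ p) []      i       = sym (ℚ.+-identityʳ (coeff (a ∷ p) i))
coeff-+ₚ (a ∷ p) (b ∷ q) zero    = refl
coeff-+ₚ (a ∷ p) (b ∷ q) (suc i) = coeff-+ₚ p q i

coeff-·ₚ : ∀ a p i → coeff (a ·ₚ p) i ≡ a *ℚ coeff p i
coeff-·ₚ a []      i       = sym (ℚ.*-zeroʳ a)
coeff-·ₚ a (b ∷ p) zero    = refl
coeff-·ₚ a (b ∷ p) (suc i) = coeff-·ₚ a p i

coeff--ₚ : ∀ p i → coeff (-ₚ p) i ≡ - coeff p i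
coeff--ₚ []      i       = refl
coeff--ₚ (a ∷ p) zero    = refl
coeff--ₚ (a ∷ p) (suc i) = coeff--ₚ p i

module ≋ = IsEquivalence ≋-isEquivalence

≡⇒≋ : ∀ {p q} → p ≡ q → p ≋ q
≡⇒≋ refl = ≋.refl

≋-setoid : Setoid 0ℓ 0ℓ
≋-setoid = record { isEquivalence = ≋-isEquivalence }

∷-cong : ∀ {a b p q} → a ≡ b → p ≋ q → a ∷ p ≋ b ∷ q
∷-cong a≡b (coeffwise e) = coeffwise λ { zero → a≡b ; (suc i) → e i }

0∷-≋[] : ∀ {p} → p ≋ [] → 0ℚ ∷ p ≋ []
0∷-≋[] (coeffwise e) = coeffwise λ { zero → refl ; (suc i) → e i }

+ₚ-cong : ∀ {p p′ q q′} → p ≋ p′ → q ≋ q′ → p +ₚ q ≋ p′ +ₚ q′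
+ₚ-cong {p} {p′} {q} {q′} (coeffwise e) (coeffwise f) = coeffwise λ i → begin
  coeff (p +ₚ q) i         ≡⟨ coeff-+ₚ p q i ⟩
  coeff p i +ℚ coeff q i   ≡⟨ cong₂ _+ℚ_ (e i) (f i) ⟩
  coeff p′ i +ℚ coeff q′ i ≡⟨ coeff-+ₚ p′ q′ i ⟨
  coeff (p′ +ₚ q′) i       ∎
  where open ≡-Reasoning

+ₚ-comm : ∀ p q → p +ₚ q ≋ q +ₚ p
+ₚ-comm p q = coeffwise λ i → begin
  coeff (p +ₚ q) i       ≡⟨ coeff-+ₚ p q i ⟩
  coeff p i +ℚ coeff q i ≡⟨ ℚ.+-comm (coeff p i) (coeff q i) ⟩
  coeff q i +ℚ coeff p i ≡⟨ coeff-+ₚ q p i ⟨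
  coeff (q +ₚ p) i       ∎
  where open ≡-Reasoning

+ₚ-assoc : ∀ p q r → (p +ₚ q) +ₚ r ≋ p +ₚ (q +ₚ r)
+ₚ-assoc p q r = coeffwise λ i → begin
  coeff ((p +ₚ q) +ₚ r) i                  ≡⟨ coeff-+ₚ (p +ₚ q) r i ⟩
  coeff (p +ₚ q) i +ℚ coeff r i            ≡⟨ cong (_+ℚ coeff r i) (coeff-+ₚ p q i) ⟩
  (coeff p i +ℚ coeff q i) +ℚ coeff r i    ≡⟨ ℚ.+-assoc (coeff p i) (coeff q i) (coeff r i) ⟩
  coeff p i +ℚ (coeff q i +ℚ coeff r i)    ≡⟨ cong (coeff p i +ℚ_) (coeff-+ₚ q r i) ⟨
  coeff p i +ℚ coeff (q +ₚ r) i            ≡⟨ coeff-+ₚ p (q +ₚ r) i ⟨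
  coeff (p +ₚ (q +ₚ r)) i                  ∎
  where open ≡-Reasoning

+ₚ-identityʳ : ∀ p → p +ₚ [] ≋ p
+ₚ-identityʳ p = coeffwise λ i → trans (coeff-+ₚ p [] i) (ℚ.+-identityʳ (coeff p i))

-ₚ-cong : ∀ {p q} → p ≋ q → -ₚ p ≋ -ₚ q
-ₚ-cong {p} {q} (coeffwise e) = coeffwise λ i →
  trans (coeff--ₚ p i) (trans (cong -_ (e i)) (sym (coeff--ₚ q i)))

-ₚ‿inverseʳ : ∀ p → p +ₚ -ₚ p ≋ []
-ₚ‿inverseʳ p = coeffwise λ i → begin
  coeff (p +ₚ -ₚ p) i        ≡⟨ coeff-+ₚ p (-ₚ p) i ⟩
  coeff p i +ℚ coeff (-ₚ p) i ≡⟨ cong (coeff p i +ℚ_) (coeff--ₚ p i) ⟩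
  coeff p i +ℚ - coeff p i    ≡⟨ ℚ.+-inverseʳ (coeff p i) ⟩
  0ℚ                          ∎
  where open ≡-Reasoning

+ₚ-isCommutativeMonoid : IsCommutativeMonoid _≋_ _+ₚ_ []
+ₚ-isCommutativeMonoid = record
  { isMonoid = record
    { isSemigroup = record
      { isMagma = record { isEquivalence = ≋-isEquivalence ; ∙-cong = +ₚ-cong }
      ; assoc   = +ₚ-assoc
      }
    ; identity = (λ _ → ≋.refl) , +ₚ-identityʳ
    }
  ; comm = +ₚ-comm
  }

+ₚ-commutativeSemigroup : CommutativeSemigroup 0ℓ 0ℓ
+ₚ-commutativeSemigroup = record
  { isCommutativeSemigroup = IsCommutativeMonoid.isCommutativeSemigroup +ₚ-isCommutativeMonoid }

open import Algebra.Properties.CommutativeSemigroup +ₚ-commutativeSemigroup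
  using () renaming (interchange to +ₚ-interchange; x∙yz≈y∙xz to +ₚ-exchange)

·ₚ-cong : ∀ a {p q} → p ≋ q → a ·ₚ p ≋ a ·ₚ q
·ₚ-cong a {p} {q} (coeffwise e) = coeffwise λ i →
  trans (coeff-·ₚ a p i) (trans (cong (a *ℚ_) (e i)) (sym (coeff-·ₚ a q i)))

·ₚ-distrib-+ₚ : ∀ a p q → a ·ₚ (p +ₚ q) ≋ a ·ₚ p +ₚ a ·ₚ q
·ₚ-distrib-+ₚ a p q = coeffwise λ i → begin
  coeff (a ·ₚ (p +ₚ q)) i                        ≡⟨ coeff-·ₚ a (p +ₚ q) i ⟩
  a *ℚ coeff (p +ₚ q) i                          ≡⟨ cong (a *ℚ_) (coeff-+ₚ p q i) ⟩
  a *ℚ (coeff p i +ℚ coeff q i)                  ≡⟨ ℚ.*-distribˡ-+ a (coeff p i) (coeff q i) ⟩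
  a *ℚ coeff p i +ℚ a *ℚ coeff q i               ≡⟨ cong₂ _+ℚ_ (coeff-·ₚ a p i) (coeff-·ₚ a q i) ⟨
  coeff (a ·ₚ p) i +ℚ coeff (a ·ₚ q) i           ≡⟨ coeff-+ₚ (a ·ₚ p) (a ·ₚ q) i ⟨
  coeff (a ·ₚ p +ₚ a ·ₚ q) i                     ∎
  where open ≡-Reasoning

+ℚ-·ₚ-distrib : ∀ a b p → (a +ℚ b) ·ₚ p ≋ a ·ₚ p +ₚ b ·ₚ p
+ℚ-·ₚ-distrib a b p = coeffwise λ i → begin
  coeff ((a +ℚ b) ·ₚ p) i                        ≡⟨ coeff-·ₚ (a +ℚ b) p i ⟩
  (a +ℚ b) *ℚ coeff p i                          ≡⟨ ℚ.*-distribʳ-+ (coeff p i) a b ⟩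
  a *ℚ coeff p i +ℚ b *ℚ coeff p i               ≡⟨ cong₂ _+ℚ_ (coeff-·ₚ a p i) (coeff-·ₚ b p i) ⟨
  coeff (a ·ₚ p) i +ℚ coeff (b ·ₚ p) i           ≡⟨ coeff-+ₚ (a ·ₚ p) (b ·ₚ p) i ⟨
  coeff (a ·ₚ p +ₚ b ·ₚ p) i                     ∎
  where open ≡-Reasoning

·ₚ-assoc : ∀ a b p → a ·ₚ (b ·ₚ p) ≋ (a *ℚ b) ·ₚ p
·ₚ-assoc a b p = coeffwise λ i → begin
  coeff (a ·ₚ (b ·ₚ p)) i   ≡⟨ coeff-·ₚ a (b ·ₚ p) i ⟩
  a *ℚ coeff (b ·ₚ p) i     ≡⟨ cong (a *ℚ_) (coeff-·ₚ b p i) ⟩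
  a *ℚ (b *ℚ coeff p i)     ≡⟨ ℚ.*-assoc a b (coeff p i) ⟨
  (a *ℚ b) *ℚ coeff p i     ≡⟨ coeff-·ₚ (a *ℚ b) p i ⟨
  coeff ((a *ℚ b) ·ₚ p) i   ∎
  where open ≡-Reasoning

0·ₚ : ∀ p → 0ℚ ·ₚ p ≋ []
0·ₚ p = coeffwise λ i → trans (coeff-·ₚ 0ℚ p i) (ℚ.*-zeroˡ (coeff p i))

1·ₚ : ∀ p → 1ℚ ·ₚ p ≋ p
1·ₚ p = coeffwise λ i → trans (coeff-·ₚ 1ℚ p i) (ℚ.*-identityˡ (coeff p i))

*ₚ-zeroˡ : ∀ {p} q → p ≋ [] → p *ₚ q ≋ []
*ₚ-zeroˡ {[]}    q _             = ≋.refl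
*ₚ-zeroˡ {a ∷ p} q (coeffwise e) = +ₚ-cong
  (≋.trans (≡⇒≋ (cong (_·ₚ q) (e zero))) (0·ₚ q))
  (0∷-≋[] (*ₚ-zeroˡ {p} q (coeffwise λ i → e (suc i))))

*ₚ-zeroʳ : ∀ p → p *ₚ [] ≋ []
*ₚ-zeroʳ []      = ≋.refl
*ₚ-zeroʳ (a ∷ p) = 0∷-≋[] (*ₚ-zeroʳ p)

*ₚ-congˡ : ∀ {p p′} q → p ≋ p′ → p *ₚ q ≋ p′ *ₚ q
*ₚ-congˡ {[]}    q p≋p′ = ≋.sym (*ₚ-zeroˡ q (≋.sym p≋p′))
*ₚ-congˡ {a ∷ p} {[]} q p≋p′ = *ₚ-zeroˡ q p≋p′
*ₚ-congˡ {a ∷ p} {a′ ∷ p′} q (coeffwise e) = +ₚ-cong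
  (≡⇒≋ (cong (_·ₚ q) (e zero)))
  (∷-cong refl (*ₚ-congˡ {p} {p′} q (coeffwise λ i → e (suc i))))

*ₚ-congʳ : ∀ p {q q′} → q ≋ q′ → p *ₚ q ≋ p *ₚ q′
*ₚ-congʳ []      q≋q′ = ≋.refl
*ₚ-congʳ (a ∷ p) q≋q′ = +ₚ-cong (·ₚ-cong a q≋q′) (∷-cong refl (*ₚ-congʳ p q≋q′))

*ₚ-distribʳ : ∀ r p q → (p +ₚ q) *ₚ r ≋ p *ₚ r +ₚ q *ₚ r
*ₚ-distribʳ r []      q       = ≋.refl
*ₚ-distribʳ r (a ∷ p) []      = ≋.sym (+ₚ-identityʳ ((a ∷ p) *ₚ r))
*ₚ-distribʳ r (a ∷ p) (b ∷ q) = ≋.trans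
  (+ₚ-cong (+ℚ-·ₚ-distrib a b r) (∷-cong (sym (ℚ.+-identityˡ 0ℚ)) (*ₚ-distribʳ r p q)))
  (+ₚ-interchange (a ·ₚ r) (b ·ₚ r) (0ℚ ∷ p *ₚ r) (0ℚ ∷ q *ₚ r))

0∷-*ₚ : ∀ p r → (0ℚ ∷ p) *ₚ r ≋ 0ℚ ∷ p *ₚ r
0∷-*ₚ p r = +ₚ-cong (0·ₚ r) ≋.refl

·ₚ-*ₚ : ∀ a q r → (a ·ₚ q) *ₚ r ≋ a ·ₚ (q *ₚ r)
·ₚ-*ₚ a []      r = ≋.refl
·ₚ-*ₚ a (b ∷ q) r = ≋.trans
  (+ₚ-cong (≋.sym (·ₚ-assoc a b r)) (∷-cong (sym (ℚ.*-zeroʳ a)) (·ₚ-*ₚ a q r)))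
  (≋.sym (·ₚ-distrib-+ₚ a (b ·ₚ r) (0ℚ ∷ q *ₚ r)))

*ₚ-assoc : ∀ p q r → (p *ₚ q) *ₚ r ≋ p *ₚ (q *ₚ r)
*ₚ-assoc []      q r = ≋.refl
*ₚ-assoc (a ∷ p) q r = ≋.trans
  (*ₚ-distribʳ r (a ·ₚ q) (0ℚ ∷ p *ₚ q))
  (+ₚ-cong (·ₚ-*ₚ a q r) (≋.trans (0∷-*ₚ (p *ₚ q) r) (∷-cong refl (*ₚ-assoc p q r))))

*ₚ-∷ʳ : ∀ p b q → p *ₚ (b ∷ q) ≋ b ·ₚ p +ₚ (0ℚ ∷ p *ₚ q)
*ₚ-∷ʳ []      b q = ≋.sym (0∷-≋[] ≋.refl)
*ₚ-∷ʳ (a ∷ p) b q = ∷-cong (cong (_+ℚ 0ℚ) (ℚ.*-comm a b))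
  (≋.trans (+ₚ-cong ≋.refl (*ₚ-∷ʳ p b q)) (+ₚ-exchange (a ·ₚ q) (b ·ₚ p) (0ℚ ∷ p *ₚ q)))

*ₚ-comm : ∀ p q → p *ₚ q ≋ q *ₚ p
*ₚ-comm []      q = ≋.sym (*ₚ-zeroʳ q)
*ₚ-comm (a ∷ p) q = ≋.trans (+ₚ-cong ≋.refl (∷-cong refl (*ₚ-comm p q))) (≋.sym (*ₚ-∷ʳ q a p))

*ₚ-identityˡ : ∀ p → oneₚ *ₚ p ≋ p
*ₚ-identityˡ p = ≋.trans (+ₚ-cong (1·ₚ p) (0∷-≋[] ≋.refl)) (+ₚ-identityʳ p)

*ₚ-identityʳ : ∀ p → p *ₚ oneₚ ≋ p
*ₚ-identityʳ p = ≋.trans (*ₚ-comm p oneₚ) (*ₚ-identityˡ p)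

*ₚ-distribˡ : ∀ r p q → r *ₚ (p +ₚ q) ≋ r *ₚ p +ₚ r *ₚ q
*ₚ-distribˡ r p q = ≋.trans (*ₚ-comm r (p +ₚ q))
  (≋.trans (*ₚ-distribʳ r p q) (+ₚ-cong (*ₚ-comm p r) (*ₚ-comm q r)))

ℚ[x] : CommutativeRing 0ℓ 0ℓ
ℚ[x] = record
  { _≈_ = _≋_ ; _+_ = _+ₚ_ ; _*_ = _*ₚ_ ; -_ = -ₚ_ ; 0# = [] ; 1# = oneₚ
  ; isCommutativeRing = record
    { isRing = record
      { +-isAbelianGroup = record
        { isGroup = record
          { isMonoid = IsCommutativeMonoid.isMonoid +ₚ-isCommutativeMonoid
          ; inverse  = (λ p → ≋.trans (+ₚ-comm (-ₚ p) p) (-ₚ‿inverseʳ p)) , -ₚ‿inverseʳ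
          ; ⁻¹-cong  = -ₚ-cong
          }
        ; comm = +ₚ-comm
        }
      ; *-cong     = λ {p} {p′} {q} {q′} p≋p′ q≋q′ → ≋.trans (*ₚ-congˡ q p≋p′) (*ₚ-congʳ p′ q≋q′)
      ; *-assoc    = *ₚ-assoc
      ; *-identity = *ₚ-identityˡ , *ₚ-identityʳ
      ; distrib    = *ₚ-distribˡ , *ₚ-distribʳ
      }
    ; *-comm = *ₚ-comm
    }
  }

open CommutativeRing ℚ[x] using (+-group) renaming (_-_ to _-ₚ_)
open import Algebra.Properties.CommutativeSemigroup.Divisibility (CommutativeRing.*-commutativeSemigroup ℚ[x])
  using (_∣_; _,_; ∣ʳ-trans; ∣ʳ-respʳ-≈; ∣ʳ-respˡ-≈; x∣ʳy⇒x∣ʳzy; xy≈z⇒y∣ʳz)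
open import Algebra.Properties.CommutativeSemigroup (CommutativeRing.*-commutativeSemigroup ℚ[x])
  using () renaming (x∙yz≈y∙xz to *ₚ-exchange)
open import Algebra.Properties.Monoid.Divisibility (CommutativeRing.*-monoid ℚ[x]) using (∣ʳ-refl)
open import Algebra.Properties.Semiring.Exp (CommutativeRing.semiring ℚ[x]) using (_^_; ^-assocʳ)
open import Algebra.Definitions.RawSemiring (Semiring.rawSemiring (CommutativeRing.semiring ℚ[x]))
  using () renaming (_×_ to _×ₚ_)
open import Algebra.Properties.Group +-group using (x∙y⁻¹≈ε⇒x≈y)
open import Algebra.Properties.Ring (CommutativeRing.ring ℚ[x]) using (x[y-z]≈xy-xz)
open import Algebra.Definitions.RawMonoid (Monoid.rawMonoid ℚ.+-0-monoid) using () renaming (_×_ to _×ℚ_)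
open Comaximality ℚ[x]
open GeometricSums ℚ[x]
open SubsetProducts ℚ[x]

X : Poly
X = monomial 1

monomial≋X^ : ∀ m → monomial m ≋ X ^ m
monomial≋X^ zero    = ≋.refl
monomial≋X^ (suc m) = ≋.sym (≋.trans (*ₚ-congʳ X (≋.sym (monomial≋X^ m))) X*ₚ≋0∷)
  where
  X*ₚ≋0∷ : X *ₚ monomial m ≋ 0ℚ ∷ monomial m
  X*ₚ≋0∷ = +ₚ-cong (0·ₚ (monomial m)) (∷-cong refl (*ₚ-identityˡ (monomial m)))

xpowMinusOne≋X^-1 : ∀ m → xpowMinusOne m ≋ X ^ m -ₚ oneₚ
xpowMinusOne≋X^-1 m = +ₚ-cong (monomial≋X^ m) ≋.refl

geomPoly≋geom : ∀ m j → geomPoly m j ≋ geom (X ^ m) j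
geomPoly≋geom m zero    = ≋.refl
geomPoly≋geom m (suc j) = +ₚ-cong (geomPoly≋geom m j) (begin
  monomial (j ℕ.* m)  ≈⟨ monomial≋X^ (j ℕ.* m) ⟩
  X ^ (j ℕ.* m)       ≡⟨ cong (X ^_) (ℕ.*-comm j m) ⟩
  X ^ (m ℕ.* j)       ≈⟨ ^-assocʳ X m j ⟨
  (X ^ m) ^ j         ∎)
  where open SetoidReasoning ≋-setoid

if-cong : ∀ b {u u′ v v′} → u ≋ u′ → v ≋ v′ → (if b then u else v) ≋ (if b then u′ else v′)
if-cong true  u≋u′ _    = u≋u′
if-cong false _    v≋v′ = v≋v′

pcNum≋Num : ∀ k p → pcNum k p ≋ Num k p X
pcNum≋Num k p = ∏-map-cong
  (λ I → if-cong (evenᵇ (k ℕ.∸ card I)) (xpowMinusOne≋X^-1 (subProd I p)) ≋.refl) (subsets k)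

pcDen≋Den : ∀ k p → pcDen k p ≋ Den k p X
pcDen≋Den k p = ∏-map-cong
  (λ I → if-cong (evenᵇ (k ℕ.∸ card I)) ≋.refl (xpowMinusOne≋X^-1 (subProd I p))) (subsets k)

-- Leading terms and monic polynomials

record HasLeadingTerm (p : Poly) (d : ℕ) (c : ℚ) : Set where
  constructor leading
  field
    coeff-deg   : coeff p d ≡ c
    nonzero     : c ≢ 0ℚ
    coeff-above : ∀ i → d < i → coeff p i ≡ 0ℚ
open HasLeadingTerm

monic⇒leading : ∀ {p} → Monic p → Σ ℕ λ d → HasLeadingTerm p d 1ℚ
monic⇒leading (d , coeff≡1 , above) = d , leading coeff≡1 ℚ.1≢0 above

leading⇒≉[] : ∀ {p d c} → HasLeadingTerm p d c → ¬ p ≋ []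
leading⇒≉[] t (coeffwise p≋[]) = nonzero t (trans (sym (coeff-deg t)) (p≋[] _))

leading-resp-≋ : ∀ {p q d c} → p ≋ q → HasLeadingTerm p d c → HasLeadingTerm q d c
leading-resp-≋ (coeffwise e) t =
  leading (trans (sym (e _)) (coeff-deg t)) (nonzero t) (λ i d<i → trans (sym (e i)) (coeff-above t i d<i))

leading-coeff-unique : ∀ {p d d′ c c′} → HasLeadingTerm p d c → HasLeadingTerm p d′ c′ → c ≡ c′
leading-coeff-unique {d = d} {d′} t t′ with ℕ.<-cmp d d′
... | tri< d<d′ _ _ = contradiction (trans (sym (coeff-deg t′)) (coeff-above t d′ d<d′)) (nonzero t′)
... | tri≈ _ refl _ = trans (sym (coeff-deg t)) (coeff-deg t′)
... | tri> _ _ d′<d = contradiction (trans (sym (coeff-deg t)) (coeff-above t′ d d′<d)) (nonzero t)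

leading-∷ : ∀ {a p d c} → HasLeadingTerm p d c → HasLeadingTerm (a ∷ p) (suc d) c
leading-∷ t = leading (coeff-deg t) (nonzero t) (λ { (suc i) (s≤s d<i) → coeff-above t i d<i })

leading-∷⁻ : ∀ {a p d c} → HasLeadingTerm (a ∷ p) (suc d) c → HasLeadingTerm p d c
leading-∷⁻ t = leading (coeff-deg t) (nonzero t) (λ i d<i → coeff-above t (suc i) (s≤s d<i))

≋[]? : (p : Poly) → Dec (p ≋ [])
≋[]? []      = yes ≋.refl
≋[]? (a ∷ p) with a ℚ.≟ 0ℚ | ≋[]? p
... | yes a≡0 | yes p≋[] = yes (coeffwise λ { zero → a≡0 ; (suc i) → coeff-≡ p≋[] i })
... | no a≢0  | _        = no λ a∷p≋[] → a≢0 (coeff-≡ a∷p≋[] zero)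
... | _       | no p≉[]  = no λ a∷p≋[] → p≉[] (coeffwise λ i → coeff-≡ a∷p≋[] (suc i))

leading-term : ∀ p → ¬ p ≋ [] → Σ ℕ λ d → Σ ℚ λ c → HasLeadingTerm p d c
leading-term []      p≉[] = contradiction ≋.refl p≉[]
leading-term (a ∷ p) a∷p≉[] with ≋[]? p
... | yes p≋[] = 0 , a , leading refl
  (λ a≡0 → a∷p≉[] (coeffwise λ { zero → a≡0 ; (suc i) → coeff-≡ p≋[] i }))
  (λ { (suc i) _ → coeff-≡ p≋[] i })
... | no p≉[] with leading-term p p≉[]
...   | d , c , t = suc d , c , leading-∷ t

leading-·ₚ : ∀ {a q e} → a ≢ 0ℚ → HasLeadingTerm q e 1ℚ → HasLeadingTerm (a ·ₚ q) e a
leading-·ₚ {a} {q} a≢0 t = leading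
  (trans (coeff-·ₚ a q _) (trans (cong (a *ℚ_) (coeff-deg t)) (ℚ.*-identityʳ a)))
  a≢0
  (λ i e<i → trans (coeff-·ₚ a q i) (trans (cong (a *ℚ_) (coeff-above t i e<i)) (ℚ.*-zeroʳ a)))

leading-+ₚ-lower : ∀ {r s d c} → (∀ i → d ≤ i → coeff r i ≡ 0ℚ) →
  HasLeadingTerm s d c → HasLeadingTerm (r +ₚ s) d c
leading-+ₚ-lower {r} {s} {d} {c} low t = leading
  (trans (coeff-+ₚ r s d) (trans (cong₂ _+ℚ_ (low d ℕ.≤-refl) (coeff-deg t)) (ℚ.+-identityˡ c)))
  (nonzero t)
  (λ i d<i → trans (coeff-+ₚ r s i)
    (trans (cong₂ _+ℚ_ (low i (ℕ.<⇒≤ d<i)) (coeff-above t i d<i)) (ℚ.+-identityˡ 0ℚ)))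

leading-*ₚ-monic : ∀ {p q d e c} → HasLeadingTerm p d c → HasLeadingTerm q e 1ℚ →
  HasLeadingTerm (p *ₚ q) (d ℕ.+ e) c
leading-*ₚ-monic {[]} t _ = contradiction ≋.refl (leading⇒≉[] t)
leading-*ₚ-monic {a ∷ p} {q} {zero} t u =
  leading-resp-≋ (≋.sym a∷p*q≋a·q) (subst (HasLeadingTerm (a ·ₚ q) _) (coeff-deg t)
    (leading-·ₚ (λ a≡0 → nonzero t (trans (sym (coeff-deg t)) a≡0)) u))
  where
  a∷p*q≋a·q : (a ∷ p) *ₚ q ≋ a ·ₚ q
  a∷p*q≋a·q = ≋.trans
    (+ₚ-cong ≋.refl (0∷-≋[] (*ₚ-zeroˡ {p} q (coeffwise λ i → coeff-above t (suc i) (s≤s z≤n)))))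
    (+ₚ-identityʳ (a ·ₚ q))
leading-*ₚ-monic {a ∷ p} {q} {suc d} {e} t u =
  leading-+ₚ-lower low (leading-∷ (leading-*ₚ-monic (leading-∷⁻ t) u))
  where
  low : ∀ i → suc (d ℕ.+ e) ≤ i → coeff (a ·ₚ q) i ≡ 0ℚ
  low i d+e<i = trans (coeff-·ₚ a q i)
    (trans (cong (a *ℚ_) (coeff-above u i (ℕ.≤-<-trans (ℕ.m≤n+m e d) d+e<i))) (ℚ.*-zeroʳ a))

monic-resp-≋ : ∀ {p q} → p ≋ q → Monic p → Monic q
monic-resp-≋ (coeffwise e) (d , coeff≡1 , above) =
  d , trans (sym (e d)) coeff≡1 , λ i d<i → trans (sym (e i)) (above i d<i)

leading⇒monic : ∀ {p d} → HasLeadingTerm p d 1ℚ → Monic p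
leading⇒monic {d = d} t = d , coeff-deg t , coeff-above t

monic⇒cancellable : ∀ {a} → Monic a → Cancellable a
monic⇒cancellable {a} monic {x} {y} ax≋ay with ≋[]? (x -ₚ y)
... | yes x-y≋[] = x∙y⁻¹≈ε⇒x≈y x y x-y≋[]
... | no x-y≉[] with leading-term _ x-y≉[] | monic⇒leading monic
...   | _ , _ , t | _ , u = contradiction [x-y]a≋[] (leading⇒≉[] (leading-*ₚ-monic t u))
  where
  open SetoidReasoning ≋-setoid
  [x-y]a≋[] : (x -ₚ y) *ₚ a ≋ []
  [x-y]a≋[] = begin
    (x -ₚ y) *ₚ a            ≈⟨ *ₚ-comm (x -ₚ y) a ⟩
    a *ₚ (x -ₚ y)            ≈⟨ x[y-z]≈xy-xz a x y ⟩
    a *ₚ x -ₚ a *ₚ y         ≈⟨ +ₚ-cong ax≋ay ≋.refl ⟩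
    a *ₚ y -ₚ a *ₚ y         ≈⟨ -ₚ‿inverseʳ (a *ₚ y) ⟩
    []                       ∎

monic-quotient : ∀ {a r b} → Monic a → r *ₚ a ≋ b → Monic b → Monic r
monic-quotient {a} {r} monic-a ra≋b monic-b with ≋[]? r | monic⇒leading monic-a | monic⇒leading monic-b
... | yes r≋[] | _ | _ , tb = contradiction (≋.trans (≋.sym ra≋b) (*ₚ-zeroˡ a r≋[])) (leading⇒≉[] tb)
... | no r≉[]  | _ , ta | _ , tb with leading-term r r≉[]
...   | e , c , t = e , trans (coeff-deg t) c≡1 , coeff-above t
  where
  c≡1 : c ≡ 1ℚ
  c≡1 = leading-coeff-unique (leading-resp-≋ ra≋b (leading-*ₚ-monic t ta)) tb

PowersMinusOneMonic : Poly → Set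
PowersMinusOneMonic y = ∀ j → 1 ≤ j → Monic (y ^ j -ₚ oneₚ)

^-powersMinusOneMonic : ∀ {y} q → 1 ≤ q → PowersMinusOneMonic y → PowersMinusOneMonic (y ^ q)
^-powersMinusOneMonic {y} q 1≤q monic j 1≤j =
  monic-resp-≋ (+ₚ-cong (≋.sym (^-assocʳ y q j)) ≋.refl) (monic (q ℕ.* j) (ℕ.*-mono-≤ 1≤q 1≤j))

leading-monomial : ∀ m → HasLeadingTerm (monomial m) m 1ℚ
leading-monomial zero    = leading refl ℚ.1≢0 λ { (suc i) _ → refl }
leading-monomial (suc m) = leading-∷ (leading-monomial m)

powersMinusOneMonic-X : PowersMinusOneMonic X
powersMinusOneMonic-X (suc j) _ =
  monic-resp-≋ (≋.trans (+ₚ-comm [ - 1ℚ ] (monomial (suc j))) (xpowMinusOne≋X^-1 (suc j)))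
    (leading⇒monic (leading-+ₚ-lower {[ - 1ℚ ]} (λ { zero () ; (suc i) _ → refl })
                                                 (leading-monomial (suc j))))

j×1ℚ>0 : ∀ j → 0ℚ <ℚ suc j ×ℚ 1ℚ
j×1ℚ>0 j = ℚ.+-mono-<-≤ (ℚ.positive⁻¹ 1ℚ) (j×1ℚ≥0 j)
  where
  j×1ℚ≥0 : ∀ j → 0ℚ ≤ℚ j ×ℚ 1ℚ
  j×1ℚ≥0 zero    = ℚ.≤-refl
  j×1ℚ≥0 (suc j) = ℚ.+-mono-≤ (ℚ.nonNegative⁻¹ 1ℚ) (j×1ℚ≥0 j)

j×oneₚ≋[j×1ℚ] : ∀ j → j ×ₚ oneₚ ≋ [ j ×ℚ 1ℚ ]
j×oneₚ≋[j×1ℚ] zero    = ≋.sym (0∷-≋[] ≋.refl)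
j×oneₚ≋[j×1ℚ] (suc j) = +ₚ-cong ≋.refl (j×oneₚ≋[j×1ℚ] j)

invertible-j×oneₚ : ∀ j → 1 ≤ j → Invertible (j ×ₚ oneₚ)
invertible-j×oneₚ (suc j) _ = [ 1/c ] , ≋.trans (*ₚ-congʳ [ 1/c ] (j×oneₚ≋[j×1ℚ] (suc j)))
  (∷-cong (trans (ℚ.+-identityʳ _) (ℚ.*-inverseˡ c {{c≢0}})) ≋.refl)
  where
  c = suc j ×ℚ 1ℚ
  c≢0 = >-nonZero (j×1ℚ>0 j)
  1/c = (1/ c) {{c≢0}}

-- Pseudocyclotomic polynomials as greatest common divisors

open import Algebra.Properties.CommutativeSemigroup ℕ.*-commutativeSemigroup
  using () renaming (x∙yz≈y∙xz to ℕ-*-exchange)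

cofactor : (k : ℕ) → (Fin k → ℕ) → Fin k → ℕ
cofactor (suc k) p zero    = fullProd k (tail p)
cofactor (suc k) p (suc i) = head p ℕ.* cofactor k (tail p) i

fullProd≡p*cofactor : ∀ k p i → fullProd k p ≡ p i ℕ.* cofactor k p i
fullProd≡p*cofactor (suc k) p zero    = refl
fullProd≡p*cofactor (suc k) p (suc i) =
  trans (cong (head p ℕ.*_) (fullProd≡p*cofactor k (tail p) i)) (ℕ-*-exchange (head p) (p (suc i)) _)

1≤fullProd : ∀ k p → (∀ i → 1 ≤ p i) → 1 ≤ fullProd k p
1≤fullProd zero    p pos = s≤s z≤n
1≤fullProd (suc k) p pos = ℕ.*-mono-≤ (pos zero) (1≤fullProd k (tail p) (pos ∘ suc))

1≤cofactor : ∀ k p → (∀ i → 1 ≤ p i) → ∀ i → 1 ≤ cofactor k p i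
1≤cofactor (suc k) p pos zero    = 1≤fullProd k (tail p) (pos ∘ suc)
1≤cofactor (suc k) p pos (suc i) = ℕ.*-mono-≤ (pos zero) (1≤cofactor k (tail p) (pos ∘ suc) i)

^-^-comm : ∀ y a b → (y ^ a) ^ b ≋ (y ^ b) ^ a
^-^-comm y a b =
  ≋.trans (^-assocʳ y a b) (≋.trans (≡⇒≋ (cong (y ^_) (ℕ.*-comm a b))) (≋.sym (^-assocʳ y b a)))

-- Φ is Φ̃_p(y). The member y^n − 1 of the family makes the case k = 0 (Φ = y − 1)
-- fit, and the universal property is stated for all multiples Φ z, the form in
-- which the inductive step uses it.
record PseudocyclotomicGCD (k : ℕ) (p : Fin k → ℕ) (y : Poly) : Set where
  field
    Φ         : Poly
    Φ*Den≋Num : Φ *ₚ Den k p y ≋ Num k p y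
    monic     : Monic Φ
    ∣y^n-1    : Φ ∣ y ^ fullProd k p -ₚ oneₚ
    ∣geom     : ∀ i → Φ ∣ geom (y ^ cofactor k p i) (p i)
    greatest  : ∀ h z → h ∣ (y ^ fullProd k p -ₚ oneₚ) *ₚ z →
                (∀ i → h ∣ geom (y ^ cofactor k p i) (p i) *ₚ z) → h ∣ Φ *ₚ z

pseudocyclotomicGCD-zero : ∀ p {y} → PowersMinusOneMonic y → PseudocyclotomicGCD 0 p y
pseudocyclotomicGCD-zero p {y} monic-y = record
  { Φ         = y ^ 1 -ₚ oneₚ
  ; Φ*Den≋Num = *ₚ-congʳ (y ^ 1 -ₚ oneₚ) (*ₚ-identityˡ oneₚ)
  ; monic     = monic-y 1 (s≤s z≤n)
  ; ∣y^n-1    = ∣ʳ-refl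
  ; ∣geom     = λ ()
  ; greatest  = λ h z h∣[y-1]z _ → h∣[y-1]z
  }

module InductiveStep
  {k} (p : Fin (suc k) → ℕ) (pos : ∀ i → 1 ≤ p i)
  (coprime : ∀ i j → i ≢ j → Coprime (p i) (p j))
  {y} (monic-y : PowersMinusOneMonic y)
  (G₁ : PseudocyclotomicGCD k (tail p) y)
  (G₂ : PseudocyclotomicGCD k (tail p) (y ^ head p))
  where

  -- Φ₁ = Φ̃_p′(y), Φ₂ = Φ̃_p′(y^q), and the quotient R = Φ₂/Φ₁ is Φ̃_p(y).
  open PseudocyclotomicGCD G₁ using () renaming
    ( Φ to Φ₁; Φ*Den≋Num to Φ₁*Den≋Num; monic to monic-Φ₁
    ; ∣y^n-1 to Φ₁∣y^n′-1; ∣geom to Φ₁∣geom; greatest to greatest₁)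
  open PseudocyclotomicGCD G₂ using () renaming
    ( Φ to Φ₂; Φ*Den≋Num to Φ₂*Den≋Num; monic to monic-Φ₂
    ; ∣y^n-1 to Φ₂∣y^n-1; ∣geom to Φ₂∣geom; greatest to greatest₂)
  open SetoidReasoning ≋-setoid

  q : ℕ
  q = head p

  p′ : Fin k → ℕ
  p′ = tail p

  n′ : ℕ
  n′ = fullProd k p′

  c : Fin k → ℕ
  c = cofactor k p′

  G₀ : Poly
  G₀ = geom (y ^ n′) q

  [y^n′-1]*G₀ : (y ^ n′ -ₚ oneₚ) *ₚ G₀ ≋ (y ^ q) ^ n′ -ₚ oneₚ
  [y^n′-1]*G₀ = ≋.trans ([y-1]*geom≈y^j-1 (y ^ n′) q) (+ₚ-cong (^-^-comm y n′ q) ≋.refl)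

  Φ₁∣Φ₂ : Φ₁ ∣ Φ₂
  Φ₁∣Φ₂ = ∣ʳ-respʳ-≈ (*ₚ-identityʳ Φ₂) (greatest₂ Φ₁ oneₚ Φ₁∣y^n-1 Φ₁∣geom₂)
    where
    Φ₁∣y^n-1 : Φ₁ ∣ ((y ^ q) ^ n′ -ₚ oneₚ) *ₚ oneₚ
    Φ₁∣y^n-1 = ∣ʳ-respʳ-≈ (≋.trans (≋.trans (*ₚ-comm G₀ _) [y^n′-1]*G₀) (≋.sym (*ₚ-identityʳ _)))
      (x∣ʳy⇒x∣ʳzy G₀ Φ₁∣y^n′-1)
    Φ₁∣geom₂ : ∀ j → Φ₁ ∣ geom ((y ^ q) ^ c j) (p′ j) *ₚ oneₚ
    Φ₁∣geom₂ j = ∣ʳ-respʳ-≈ (≋.trans (geom-congˡ (p′ j) (^-^-comm y (c j) q)) (≋.sym (*ₚ-identityʳ _)))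
      (∣ʳ-trans (Φ₁∣geom j)
        (geom-∣-geom {y ^ c j}
          (monic⇒cancellable {y ^ c j -ₚ oneₚ} (monic-y (c j) (1≤cofactor k p′ (pos ∘ suc) j)))
                     (coprime (suc j) zero λ ())))

  R : Poly
  R = let (r , _) = Φ₁∣Φ₂ in r

  R*Φ₁≋Φ₂ : R *ₚ Φ₁ ≋ Φ₂
  R*Φ₁≋Φ₂ = let (_ , e) = Φ₁∣Φ₂ in e

  R∣Φ₂ : R ∣ Φ₂
  R∣Φ₂ = xy≈z⇒y∣ʳz Φ₁ R (≋.trans (*ₚ-comm Φ₁ R) R*Φ₁≋Φ₂)

  R*Den≋Num : R *ₚ Den (suc k) p y ≋ Num (suc k) p y
  R*Den≋Num = begin
    R *ₚ Den (suc k) p y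
      ≈⟨ *ₚ-congʳ R (Den-suc k p y) ⟩
    R *ₚ (N₁ *ₚ D₂)
      ≈⟨ *ₚ-congʳ R (*ₚ-congˡ D₂ Φ₁*Den≋Num) ⟨
    R *ₚ ((Φ₁ *ₚ D₁) *ₚ D₂)
      ≈⟨ *ₚ-congʳ R (≋.trans (*ₚ-congˡ D₂ (*ₚ-comm Φ₁ D₁)) (*ₚ-assoc D₁ Φ₁ D₂)) ⟩
    R *ₚ (D₁ *ₚ (Φ₁ *ₚ D₂))
      ≈⟨ *ₚ-exchange R D₁ (Φ₁ *ₚ D₂) ⟩
    D₁ *ₚ (R *ₚ (Φ₁ *ₚ D₂))
      ≈⟨ *ₚ-congʳ D₁ (≋.trans (≋.sym (*ₚ-assoc R Φ₁ D₂)) (*ₚ-congˡ D₂ R*Φ₁≋Φ₂)) ⟩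
    D₁ *ₚ (Φ₂ *ₚ D₂)
      ≈⟨ *ₚ-congʳ D₁ Φ₂*Den≋Num ⟩
    D₁ *ₚ N₂
      ≈⟨ Num-suc k p y ⟨
    Num (suc k) p y                             ∎
    where
    N₁ = Num k p′ y
    D₁ = Den k p′ y
    D₂ = Den k p′ (y ^ q)
    N₂ = Num k p′ (y ^ q)

  R∣y^n-1 : R ∣ y ^ (q ℕ.* n′) -ₚ oneₚ
  R∣y^n-1 = ∣ʳ-trans R∣Φ₂ (∣ʳ-respʳ-≈ (+ₚ-cong (^-assocʳ y q n′) ≋.refl) Φ₂∣y^n-1)

  R∣G₀ : R ∣ G₀
  R∣G₀ = cancellable⇒∣-cancel {Φ₁} {R} {G₀} (monic⇒cancellable {Φ₁} monic-Φ₁)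
    (∣ʳ-respˡ-≈ (≋.trans (≋.sym R*Φ₁≋Φ₂) (*ₚ-comm R Φ₁)) (greatest₁ Φ₂ G₀ Φ₂∣[y^n′-1]G₀ Φ₂∣geom*G₀))
    where
    Φ₂∣[y^n′-1]G₀ : Φ₂ ∣ (y ^ n′ -ₚ oneₚ) *ₚ G₀
    Φ₂∣[y^n′-1]G₀ = ∣ʳ-respʳ-≈ (≋.sym [y^n′-1]*G₀) Φ₂∣y^n-1
    Φ₂∣geom*G₀ : ∀ j → Φ₂ ∣ geom (y ^ c j) (p′ j) *ₚ G₀
    Φ₂∣geom*G₀ j = ∣ʳ-respʳ-≈ geom-product (x∣ʳy⇒x∣ʳzy (geom u q)
      (∣ʳ-respʳ-≈ (geom-congˡ (p′ j) (^-^-comm y q (c j))) (Φ₂∣geom j)))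
      where
      u = y ^ c j
      geom-product : geom u q *ₚ geom (u ^ q) (p′ j) ≋ geom u (p′ j) *ₚ G₀
      geom-product = begin
        geom u q *ₚ geom (u ^ q) (p′ j)          ≈⟨ geom-*-geom u q (p′ j) ⟩
        geom u (p′ j ℕ.* q)                      ≡⟨ cong (geom u) (ℕ.*-comm (p′ j) q) ⟩
        geom u (q ℕ.* p′ j)                      ≈⟨ geom-*-geom u (p′ j) q ⟨
        geom u (p′ j) *ₚ geom (u ^ p′ j) q       ≈⟨ *ₚ-congʳ (geom u (p′ j)) (geom-congˡ q u^p′j≋y^n′) ⟩
        geom u (p′ j) *ₚ G₀                      ∎
        where
        u^p′j≋y^n′ : u ^ p′ j ≋ y ^ n′
        u^p′j≋y^n′ = ≋.trans (^-assocʳ y (c j) (p′ j))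
          (≡⇒≋ (cong (y ^_) (trans (ℕ.*-comm (c j) (p′ j)) (sym (fullProd≡p*cofactor k p′ j)))))

  R∣geom : ∀ i → R ∣ geom (y ^ cofactor (suc k) p i) (p i)
  R∣geom zero    = R∣G₀
  R∣geom (suc j) = ∣ʳ-trans R∣Φ₂ (∣ʳ-respʳ-≈ (geom-congˡ (p′ j) (^-assocʳ y q (c j))) (Φ₂∣geom j))

  R-greatest : ∀ h z → h ∣ (y ^ (q ℕ.* n′) -ₚ oneₚ) *ₚ z →
    (∀ i → h ∣ geom (y ^ cofactor (suc k) p i) (p i) *ₚ z) → h ∣ R *ₚ z
  R-greatest h z h∣[y^n-1]z h∣geom*z =
    comaximal⇒∣xz∧∣yz⇒∣z Φ₁-G₀-comaximal h∣Φ₁Rz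
      (∣ʳ-respʳ-≈ (*ₚ-exchange R G₀ z) (x∣ʳy⇒x∣ʳzy R (h∣geom*z zero)))
    where
    Φ₁-G₀-comaximal : Comaximal Φ₁ G₀
    Φ₁-G₀-comaximal = comaximal-∣ˡ Φ₁∣y^n′-1
      (comaximal-sym (comaximal-geom-[y-1] {y ^ n′} {q} (invertible-j×oneₚ q (pos zero))))
    h∣Φ₂z : h ∣ Φ₂ *ₚ z
    h∣Φ₂z = greatest₂ h z
      (∣ʳ-respʳ-≈ (*ₚ-congˡ z (+ₚ-cong (≋.sym (^-assocʳ y q n′)) ≋.refl)) h∣[y^n-1]z)
      (λ j → ∣ʳ-respʳ-≈ (*ₚ-congˡ z (geom-congˡ (p′ j) (≋.sym (^-assocʳ y q (c j))))) (h∣geom*z (suc j)))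
    h∣Φ₁Rz : h ∣ Φ₁ *ₚ (R *ₚ z)
    h∣Φ₁Rz = ∣ʳ-respʳ-≈
      (≋.trans (*ₚ-congˡ z (≋.trans (≋.sym R*Φ₁≋Φ₂) (*ₚ-comm R Φ₁))) (*ₚ-assoc Φ₁ R z)) h∣Φ₂z

  pseudocyclotomicGCD-suc : PseudocyclotomicGCD (suc k) p y
  pseudocyclotomicGCD-suc = record
    { Φ         = R
    ; Φ*Den≋Num = R*Den≋Num
    ; monic     = monic-quotient {Φ₁} {R} {Φ₂} monic-Φ₁ R*Φ₁≋Φ₂ monic-Φ₂
    ; ∣y^n-1    = R∣y^n-1
    ; ∣geom     = R∣geom
    ; greatest  = R-greatest
    }

pseudocyclotomicGCD : ∀ k p → (∀ i → 1 ≤ p i) → (∀ i j → i ≢ j → Coprime (p i) (p j)) →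
  ∀ {y} → PowersMinusOneMonic y → PseudocyclotomicGCD k p y
pseudocyclotomicGCD zero    p _   _       monic-y = pseudocyclotomicGCD-zero p monic-y
pseudocyclotomicGCD (suc k) p pos coprime monic-y =
  InductiveStep.pseudocyclotomicGCD-suc p pos coprime monic-y
    (pseudocyclotomicGCD k (tail p) (pos ∘ suc) coprime′ monic-y)
    (pseudocyclotomicGCD k (tail p) (pos ∘ suc) coprime′ (^-powersMinusOneMonic (head p) (pos zero) monic-y))
  where
  coprime′ : ∀ i j → i ≢ j → Coprime (tail p i) (tail p j)
  coprime′ i j i≢j = coprime (suc i) (suc j) (i≢j ∘ Fin.suc-injective)

∣geom⇒∣Φ : ∀ {k p y} (G : PseudocyclotomicGCD (suc k) p y) h →
  (∀ i → h ∣ geom (y ^ cofactor (suc k) p i) (p i)) → h ∣ PseudocyclotomicGCD.Φ G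
∣geom⇒∣Φ {k} {p} {y} G h h∣geom =
  ∣ʳ-respʳ-≈ (*ₚ-identityʳ Φ) (greatest h oneₚ (∣-*ₚ-oneₚ h∣y^n-1) (∣-*ₚ-oneₚ ∘ h∣geom))
  where
  open PseudocyclotomicGCD G
  ∣-*ₚ-oneₚ : ∀ {d f} → d ∣ f → d ∣ f *ₚ oneₚ
  ∣-*ₚ-oneₚ = ∣ʳ-respʳ-≈ (≋.sym (*ₚ-identityʳ _))
  n′ = fullProd k (tail p)
  h∣y^n-1 : h ∣ y ^ fullProd (suc k) p -ₚ oneₚ
  h∣y^n-1 = ∣ʳ-trans (h∣geom zero) (∣ʳ-respʳ-≈
    (+ₚ-cong (≋.trans (^-^-comm y n′ (head p)) (^-assocʳ y (head p) n′)) ≋.refl)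
    (geom∣y^j-1 (y ^ n′) (head p)))

∣ₚ⇒∣ : ∀ {d f} → d ∣ₚ f → d ∣ f
∣ₚ⇒∣ (r , e) = r , coeffwise e

∣⇒∣ₚ : ∀ {d f} → d ∣ f → d ∣ₚ f
∣⇒∣ₚ (r , e) = r , coeff-≡ e

gcdFamily≋geom : ∀ k p pos i → gcdFamily k p pos i ≋ geom (X ^ cofactor k p i) (p i)
gcdFamily≋geom k p pos i =
  ≋.trans (≡⇒≋ (cong (λ m → geomPoly m (p i)) n/pᵢ≡cofactor)) (geomPoly≋geom _ (p i))
  where
  instance _ = ℕ.>-nonZero (pos i)
  n/pᵢ≡cofactor : fullProd k p / p i ≡ cofactor k p i
  n/pᵢ≡cofactor = trans (cong (_/ p i) (trans (fullProd≡p*cofactor k p i) (ℕ.*-comm (p i) _)))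
    (m*n/n≡m (cofactor k p i) (p i))

proposition4p4 : (k : ℕ) → 1 ≤ k → (p : Fin k → ℕ) → (pos : (i : Fin k) → 1 ≤ p i)
    → ((i j : Fin k) → i ≢ j → Coprime (p i) (p j))
    → Σ Poly λ Φ → IsPseudocyclotomic k p Φ × IsMonicGCD Φ (gcdFamily k p pos)
proposition4p4 (suc k) _ p pos coprime =
  Φ , pseudocyclotomic , monic , Φ∣family ,
  λ h h∣family → ∣⇒∣ₚ (∣geom⇒∣Φ G h λ i → ∣ʳ-respʳ-≈ (family≋geom i) (∣ₚ⇒∣ (h∣family i)))
  where
  G = pseudocyclotomicGCD (suc k) p pos coprime powersMinusOneMonic-X
  open PseudocyclotomicGCD G
  family≋geom = gcdFamily≋geom (suc k) p pos

  pseudocyclotomic : IsPseudocyclotomic (suc k) p Φ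
  pseudocyclotomic = coeff-≡ (≋.trans (*ₚ-congʳ Φ (pcDen≋Den (suc k) p))
                               (≋.trans Φ*Den≋Num (≋.sym (pcNum≋Num (suc k) p))))

  Φ∣family : ∀ i → Φ ∣ₚ gcdFamily (suc k) p pos i
  Φ∣family i = ∣⇒∣ₚ (∣ʳ-respʳ-≈ (≋.sym (family≋geom i)) (∣geom i))
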